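{- Let $n$ be a positive integer and let $w_1 \leq \dots \leq w_m$ be a feasible partition of $n$. Then for every $i$ with $1 \leq i \leq m$, $R_i \leq 3R_{i-1} + 1$.
   Context: A feasible partition of a positive integer $n$ is a nondecreasing sequence of positive integers $w_1 \leq \dots \leq w_m$ with $w_1 + \dots + w_m = n$ such that (i) every integer $k$ with $1 \leq k \leq n$ can be written as $k = \sum_{i=1}^m u_i w_i$ with each $u_i \in \{ -1,0,1\}$, and (ii) $m$ is the minimum possible number of parts among all sequences of positive integers summing to $n$ with property (i). For such a partition, $R_i = w_1 + \dots + w_i$ for $1 \leq i \leq m$, and $R_0 = 0$. -}

module Defs where

open import Data.Nat using (ℕ; zero; suc; _+_; _≤_; _<_)
open import Data.Integer as ℤ using (ℤ; +_; 0ℤ; 1ℤ; -1ℤ)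
open import Data.Fin using (Fin; zero; suc; toℕ; inject₁)
open import Data.Product using (Σ; ∃; _×_)
open import Relation.Binary.PropositionalEquality using (_≡_)

data Sign : Set where
  neg zer pos : Sign

signVal : Sign → ℤ
signVal neg = -1ℤ
signVal zer = 0ℤ
signVal pos = 1ℤ

-- A sequence w_1,…,w_m is represented as a function Fin m → ℕ
-- (index 0 corresponds to w_1).

total : ∀ {m} → (Fin m → ℕ) → ℕ
total {zero}  w = 0
total {suc m} w = w zero + total (λ i → w (suc i))

signedSum : ∀ {m} → (Fin m → Sign) → (Fin m → ℕ) → ℤ
signedSum {zero}  u w = 0ℤ
signedSum {suc m} u w =
  signVal (u zero) ℤ.* (+ w zero) ℤ.+ signedSum (λ i → u (suc i)) (λ i → w (suc i))

Nondecreasing : ∀ {m} → (Fin m → ℕ) → Set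
Nondecreasing {m} w = ∀ (i j : Fin m) → toℕ i ≤ toℕ j → w i ≤ w j

AllPositive : ∀ {m} → (Fin m → ℕ) → Set
AllPositive {m} w = ∀ (i : Fin m) → 1 ≤ w i

Represents : ∀ {m} → ℕ → (Fin m → ℕ) → Set
Represents {m} n w =
  ∀ (k : ℕ) → 1 ≤ k → k ≤ n → Σ (Fin m → Sign) (λ u → signedSum u w ≡ + k)

record Feasible (n m : ℕ) (w : Fin m → ℕ) : Set where
  field
    positive     : AllPositive w
    nondecr      : Nondecreasing w
    sums         : total w ≡ n
    represents   : Represents n w
    minimal      : ∀ (m' : ℕ) (w' : Fin m' → ℕ) →
                     AllPositive w' → total w' ≡ n → Represents n w' → m ≤ m'

R : ∀ {m} → (Fin m → ℕ) → ℕ → ℕ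
R {zero}  w i       = 0
R {suc m} w zero    = 0
R {suc m} w (suc i) = w zero + R (λ j → w (suc j)) i

-- Write T for the total and r = R_i. If w_{i+1} > 2r + 1, look at the value k = T - (2r + 1):
-- for any signs with Σ u_j w_j = k, the deficit Σ (1 - u_j) w_j equals 2r + 1. The deficit is
-- at most 2r when every part after the first i carries the sign +1, and at least w_{i+1}
-- otherwise, so it can never be 2r + 1. Hence w_{i+1} ≤ 2r + 1 and R_{i+1} ≤ 3r + 1.
module Submission where

open import Defs
open import Data.Nat using (ℕ; zero; suc; _+_; _*_; _∸_; _≤_; _<_; z≤n; s≤s; _≤?_)
open import Data.Nat.Properties
open import Data.Fin using (Fin; zero; suc; toℕ; fromℕ<)
open import Data.Fin.Properties using (toℕ-fromℕ<)
open import Data.Integer as ℤ using (ℤ; +_)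
import Data.Integer.Properties as ℤP
open import Data.Integer.Tactic.RingSolver using (solve-∀)
open import Algebra.Properties.CommutativeSemigroup ℤP.+-commutativeSemigroup using (interchange)
open import Data.Sum using (_⊎_; inj₁; inj₂)
open import Data.Product using (proj₁; proj₂)
open import Relation.Nullary using (yes; no; contradiction)
open import Relation.Binary.PropositionalEquality

defect : Sign → ℕ
defect neg = 2
defect zer = 1
defect pos = 0

deficit : ∀ {m} → (Fin m → Sign) → (Fin m → ℕ) → ℕ
deficit u w = total (λ j → defect (u j) * w j)

signVal-+-defect : ∀ s (x : ℤ) → signVal s ℤ.* x ℤ.+ + defect s ℤ.* x ≡ x
signVal-+-defect neg = solve-∀
signVal-+-defect zer = solve-∀
signVal-+-defect pos = solve-∀

signedSum-+-deficit : ∀ {m} (u : Fin m → Sign) (w : Fin m → ℕ) →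
  signedSum u w ℤ.+ + deficit u w ≡ + total w
signedSum-+-deficit {zero}  u w = refl
signedSum-+-deficit {suc m} u w = begin
  (a ℤ.+ S) ℤ.+ + (d * w zero + D)       ≡⟨ cong (ℤ._+_ (a ℤ.+ S)) (ℤP.pos-+ (d * w zero) D) ⟩
  (a ℤ.+ S) ℤ.+ (+ (d * w zero) ℤ.+ + D) ≡⟨ interchange a S (+ (d * w zero)) (+ D) ⟩
  (a ℤ.+ + (d * w zero)) ℤ.+ (S ℤ.+ + D) ≡⟨ cong₂ ℤ._+_ head (signedSum-+-deficit (λ j → u (suc j)) (λ j → w (suc j))) ⟩
  + w zero ℤ.+ + total (λ j → w (suc j)) ∎
  where
  open ≡-Reasoning
  d = defect (u zero)
  a = signVal (u zero) ℤ.* + w zero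
  S = signedSum (λ j → u (suc j)) (λ j → w (suc j))
  D = deficit (λ j → u (suc j)) (λ j → w (suc j))
  head : a ℤ.+ + (d * w zero) ≡ + w zero
  head = trans (cong (ℤ._+_ a) (ℤP.pos-* d (w zero))) (signVal-+-defect (u zero) (+ w zero))

representation⇒deficit : ∀ {m} (u : Fin m → Sign) (w : Fin m → ℕ) {k : ℕ} →
  signedSum u w ≡ + k → k + deficit u w ≡ total w
representation⇒deficit u w {k} eq = ℤP.+-injective (begin
  + k ℤ.+ + deficit u w           ≡⟨ cong (ℤ._+ + deficit u w) eq ⟨
  signedSum u w ℤ.+ + deficit u w ≡⟨ signedSum-+-deficit u w ⟩
  + total w                       ∎)
  where open ≡-Reasoning

defect-*-bound : ∀ s a → defect s * a ≤ 2 * a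
defect-*-bound neg a = ≤-refl
defect-*-bound zer a = *-monoˡ-≤ a {1} {2} (s≤s z≤n)
defect-*-bound pos a = z≤n

defect-*-vanishes-or-≥ : ∀ s a → defect s * a ≡ 0 ⊎ a ≤ defect s * a
defect-*-vanishes-or-≥ neg a = inj₂ (m≤n*m a 2)
defect-*-vanishes-or-≥ zer a = inj₂ (m≤n*m a 1)
defect-*-vanishes-or-≥ pos a = inj₁ refl

deficit-vanishes-or-≥ : ∀ {m} (u : Fin m → Sign) (w : Fin m → ℕ) {g : ℕ} →
  (∀ j → g ≤ w j) → deficit u w ≡ 0 ⊎ g ≤ deficit u w
deficit-vanishes-or-≥ {zero}  u w g≤w = inj₁ refl
deficit-vanishes-or-≥ {suc m} u w g≤w
  with defect-*-vanishes-or-≥ (u zero) (w zero)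
     | deficit-vanishes-or-≥ (λ j → u (suc j)) (λ j → w (suc j)) (λ j → g≤w (suc j))
... | inj₂ w≤d | _         = inj₂ (≤-trans (≤-trans (g≤w zero) w≤d) (m≤m+n _ _))
... | inj₁ d≡0 | inj₁ D≡0 = inj₁ (cong₂ _+_ d≡0 D≡0)
... | inj₁ _   | inj₂ g≤D = inj₂ (≤-trans g≤D (m≤n+m _ _))

deficit-≤-2R-or-≥ : ∀ {m} (u : Fin m → Sign) (w : Fin m → ℕ) {g : ℕ} (i : ℕ) →
  (∀ j → i ≤ toℕ j → g ≤ w j) → deficit u w ≤ 2 * R w i ⊎ g ≤ deficit u w
deficit-≤-2R-or-≥ {zero}  u w i       g≤w = inj₁ z≤n
deficit-≤-2R-or-≥ {suc m} u w zero    g≤w with deficit-vanishes-or-≥ u w (λ j → g≤w j z≤n)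
... | inj₁ D≡0 = inj₁ (≤-reflexive D≡0)
... | inj₂ g≤D = inj₂ g≤D
deficit-≤-2R-or-≥ {suc m} u w (suc i) g≤w
  with deficit-≤-2R-or-≥ (λ j → u (suc j)) (λ j → w (suc j)) i (λ j i≤j → g≤w (suc j) (s≤s i≤j))
... | inj₁ D≤2R = inj₁ (begin
  defect (u zero) * w zero + _ ≤⟨ +-mono-≤ (defect-*-bound (u zero) (w zero)) D≤2R ⟩
  2 * w zero + 2 * R′         ≡⟨ *-distribˡ-+ 2 (w zero) R′ ⟨
  2 * (w zero + R′)           ∎)
  where
  open ≤-Reasoning
  R′ = R (λ j → w (suc j)) i
... | inj₂ g≤D = inj₂ (≤-trans g≤D (m≤n+m _ _))

R-zero : ∀ {m} (w : Fin m → ℕ) → R w 0 ≡ 0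
R-zero {zero}  w = refl
R-zero {suc m} w = refl

R-suc : ∀ {m} (w : Fin m → ℕ) (i : ℕ) (i<m : i < m) → R w (suc i) ≡ R w i + w (fromℕ< i<m)
R-suc {suc m} w zero    _         = trans (cong (_+_ (w zero)) (R-zero (λ j → w (suc j)))) (+-identityʳ (w zero))
R-suc {suc m} w (suc i) (s≤s i<m) =
  trans (cong (_+_ (w zero)) (R-suc (λ j → w (suc j)) i i<m)) (sym (+-assoc (w zero) _ _))

R≤total : ∀ {m} (w : Fin m → ℕ) (i : ℕ) → R w i ≤ total w
R≤total {zero}  w i       = z≤n
R≤total {suc m} w zero    = z≤n
R≤total {suc m} w (suc i) = +-monoʳ-≤ (w zero) (R≤total (λ j → w (suc j)) i)

deficit≢2R+1 : ∀ {m} (u : Fin m → Sign) (w : Fin m → ℕ) {g : ℕ} (i : ℕ) →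
  (∀ j → i ≤ toℕ j → g ≤ w j) → 2 * R w i + 1 < g → deficit u w ≢ 2 * R w i + 1
deficit≢2R+1 u w i g≤w d<g D≡d with deficit-≤-2R-or-≥ u w i g≤w
... | inj₁ D≤2R = 1+n≰n (≤-trans (≤-reflexive (trans (+-comm 1 _) (sym D≡d))) D≤2R)
... | inj₂ g≤D = <⇒≱ d<g (≤-trans g≤D (≤-reflexive D≡d))

part≤2R+1 : ∀ {m} (w : Fin m → ℕ) → Nondecreasing w → Represents (total w) w →
  ∀ i (i<m : i < m) → w (fromℕ< i<m) ≤ 2 * R w i + 1
part≤2R+1 w nondecr represents i i<m with w (fromℕ< i<m) ≤? 2 * R w i + 1
... | yes x≤d = x≤d
... | no  x≰d = contradiction D≡d (deficit≢2R+1 u w i x≤w d<x)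
  where
  x = w (fromℕ< i<m)
  d = 2 * R w i + 1
  T = total w
  d<x : d < x
  d<x = ≰⇒> x≰d
  d<T : d < T
  d<T = ≤-trans d<x (≤-trans (m≤n+m x (R w i)) (subst (_≤ T) (R-suc w i i<m) (R≤total w (suc i))))
  x≤w : ∀ j → i ≤ toℕ j → x ≤ w j
  x≤w j i≤j = nondecr (fromℕ< i<m) j (subst (_≤ toℕ j) (sym (toℕ-fromℕ< i<m)) i≤j)
  k = T ∸ d
  k+d≡T : k + d ≡ T
  k+d≡T = m∸n+n≡m (<⇒≤ d<T)
  representation = represents k (m<n⇒0<n∸m d<T) (m∸n≤m T d)
  u = proj₁ representation
  D≡d : deficit u w ≡ d
  D≡d = +-cancelˡ-≡ k _ _ (trans (representation⇒deficit u w (proj₂ representation)) (sym k+d≡T))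

mainTheorem5 : ∀ (n m : ℕ) (w : Fin m → ℕ) → 1 ≤ n → Feasible n m w →
    ∀ (i : ℕ) → 1 ≤ i → i ≤ m → R w i ≤ 3 * R w (i ∸ 1) + 1
mainTheorem5 n m w _ F (suc i) _ i<m = begin
  R w (suc i)                   ≡⟨ R-suc w i i<m ⟩
  R w i + w (fromℕ< i<m)        ≤⟨ +-monoʳ-≤ (R w i) (part≤2R+1 w nondecr represents′ i i<m) ⟩
  R w i + (2 * R w i + 1)       ≡⟨ +-assoc (R w i) (2 * R w i) 1 ⟨
  3 * R w i + 1                 ∎
  where
  open ≤-Reasoning
  open Feasible F
  represents′ : Represents (total w) w
  represents′ = subst (λ t → Represents t w) (sym sums) represents
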